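{- Let $N$ be a network based on a finite simple connected graph $X$ with capacity function $c : EX \to \{1,2,\dots\}$, and let $A$ be a cut with $c(A) = n$. Then $A \notin \mathcal{B}_{n-1}$ if and only if there are vertices $u, v \in VX$ with respect to which $A$ is thin.
   Context: A cut is a subset $A \subseteq VX$ with $A \neq \emptyset, VX$; $A^*$ is its complement, $\delta A$ the set of edges joining $A$ to $A^*$, and $c(A) = \sum_{e\in\delta A} c(e)$. A cut $A$ separates $u,v \in VX$ if it contains exactly one of them. The power set of $VX$ is a Boolean ring under symmetric difference and intersection; for an integer $k$, $\mathcal{B}_k$ denotes the subring generated by all cuts $C$ with $c(C) \le k$. A cut $A$ is thin with respect to $u,v \in VX$ if $A$ separates $u$ and $v$ and $c(A)$ is minimal among the capacities of all cuts separating $u$ and $v$. -}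

module Defs where

open import Data.Nat using (ℕ; zero; suc; _≤_; _<_; _∸_)
open import Data.Bool using (Bool; true; false; _xor_; not)
open import Data.Fin using (Fin)
open import Data.Fin.Subset using (Subset; _∩_; ⊥; ⊤; _∈_; _∉_)
open import Data.Vec using (lookup; zipWith)
open import Data.List using (allFin; map)
open import Data.Nat.ListAction using (sum)
open import Data.Product using (_×_; Σ-syntax)
open import Data.Sum using (_⊎_)
open import Relation.Binary.PropositionalEquality using (_≡_; _≢_)

-- The graph and capacity are encoded together by a symmetric function
-- cap : Fin m → Fin m → ℕ with cap u u ≡ 0: {u,v} is an edge of X iff
-- cap u v ≥ 1, and then cap u v is its capacity c({u,v}) ∈ {1,2,…}.
record Network (m : ℕ) : Set where
  field
    cap     : Fin m → Fin m → ℕ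
    cap-sym : ∀ u v → cap u v ≡ cap v u
    loopless : ∀ u → cap u u ≡ 0

open Network public

Adj : ∀ {m} → Network m → Fin m → Fin m → Set
Adj N u v = 1 ≤ cap N u v

data Reach {m} (N : Network m) : Fin m → Fin m → Set where
  here : ∀ {u} → Reach N u u
  step : ∀ {u v w} → Adj N u v → Reach N v w → Reach N u w

Connected : ∀ {m} → Network m → Set
Connected {m} N = ∀ (u v : Fin m) → Reach N u v

IsCut : ∀ {m} → Subset m → Set
IsCut A = (A ≢ ⊥) × (A ≢ ⊤)

-- c(A) = Σ_{e ∈ δA} c(e) : every edge of δA is counted once as the
-- ordered pair (u,v) with u ∈ A, v ∉ A.
crossing : ∀ {m} → Network m → Subset m → Fin m → Fin m → ℕ
crossing N A u v with lookup A u | lookup A v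
... | true  | false = cap N u v
... | _     | _     = 0

capacity : ∀ {m} → Network m → Subset m → ℕ
capacity {m} N A =
  sum (map (λ u → sum (map (λ v → crossing N A u v) (allFin m))) (allFin m))

-- symmetric difference (ring addition of the Boolean ring of subsets)
_⊕_ : ∀ {m} → Subset m → Subset m → Subset m
A ⊕ B = zipWith _xor_ A B

-- 𝓑 N k : the subring of (𝒫(VX), ⊕, ∩) generated by all cuts C with c(C) ≤ k
data 𝓑 {m} (N : Network m) (k : ℕ) : Subset m → Set where
  gen  : ∀ {C} → IsCut C → capacity N C ≤ k → 𝓑 N k C
  zero : 𝓑 N k ⊥
  unit : 𝓑 N k ⊤
  add  : ∀ {A B} → 𝓑 N k A → 𝓑 N k B → 𝓑 N k (A ⊕ B)
  mul  : ∀ {A B} → 𝓑 N k A → 𝓑 N k B → 𝓑 N k (A ∩ B)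

Separates : ∀ {m} → Subset m → Fin m → Fin m → Set
Separates A u v = (u ∈ A × v ∉ A) ⊎ (u ∉ A × v ∈ A)

Thin : ∀ {m} → Network m → Subset m → Fin m → Fin m → Set
Thin {m} N A u v =
  Separates A u v ×
  (∀ (B : Subset m) → IsCut B → Separates B u v → capacity N A ≤ capacity N B)

-- Write n = c(A). A cut of capacity < n never separates a pair u, v for which
-- A is thin, and membership "u ∈ X iff v ∈ X" is preserved by ⊕ and ∩; so
-- every set of 𝓑_{n-1} fails to separate u and v, while A does. Conversely, if
-- A is thin for no pair, then every u ∈ A and v ∉ A are separated by a cut of
-- capacity < n, which (complemented if necessary) is a set C_uv ∈ 𝓑_{n-1}
-- with u ∈ C_uv, v ∉ C_uv; then A = ⋃_{u ∈ A} ⋂_{v ∉ A} C_uv ∈ 𝓑_{n-1}.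
-- Connectivity is needed only for n ≥ 1.
module Submission where

open import Defs
open import Data.Nat using (ℕ; suc; _≤_; _<_; _∸_; _≤?_; s≤s)
open import Data.Nat.Properties using (≤-trans; ≤-reflexive; ≮⇒≥; <⇒≱; m≤m+n; m≤n+m)
open import Data.Nat.ListAction using (sum)
open import Data.Bool using (true; false; _xor_; _∧_; _∨_; not)
import Data.Bool as Bool
open import Data.Fin using (Fin)
open import Data.Fin.Properties using (any?)
open import Data.Fin.Subset using (Subset; _∩_; _∪_; ∁; ⊥; ⊤; _∈_; _∉_; _⊆_; Nonempty)
open import Data.Fin.Subset.Properties
  using (_∈?_; nonempty?; anySubset?; ∈⊤; ∉⊥; ⊆⊤; ⊆-antisym; Empty-unique;
         x∈p∩q⁺; x∈p∩q⁻; x∈p∪q⁺; x∈p∪q⁻; x∈p⇒x∉∁p; x∉p⇒x∈∁p; x∉∁p⇒x∈p; x∈∁p⇒x∉p)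
open import Data.Vec using ([]; _∷_; lookup)
open import Data.Vec.Properties using (lookup-zipWith; lookup-replicate; []=⇒lookup; lookup⇒[]=; ≡-dec)
open import Data.List using (List; []; _∷_; allFin; map)
open import Data.List.Relation.Unary.Any using (here; there)
open import Data.List.Membership.Propositional using () renaming (_∈_ to _∈ˡ_)
open import Data.List.Membership.Propositional.Properties using (∈-allFin)
open import Data.Product using (Σ-syntax; ∃-syntax; _×_; _,_; proj₁; proj₂)
open import Data.Sum using (inj₁; inj₂; [_,_])
open import Function.Bundles using (_⇔_; mk⇔; Equivalence)
open import Relation.Nullary using (¬_; Dec; yes; no; ¬?; contradiction)
open import Relation.Nullary.Decidable using (_×-dec_; _⊎-dec_; decidable-stable)
open import Relation.Binary.PropositionalEquality using (_≡_; _≢_; refl; sym; trans; cong; cong₂; subst; module ≡-Reasoning)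

private
  variable
    m k : ℕ
    N : Network m
    A C X : Subset m
    u v : Fin m

∪≡⊕⊕∩ : (p q : Subset m) → p ∪ q ≡ (p ⊕ q) ⊕ (p ∩ q)
∪≡⊕⊕∩ []       []       = refl
∪≡⊕⊕∩ (x ∷ p) (y ∷ q) = cong₂ _∷_ (∨≡xor-xor-∧ x y) (∪≡⊕⊕∩ p q)
  where
  ∨≡xor-xor-∧ : ∀ x y → (x ∨ y) ≡ ((x xor y) xor (x ∧ y))
  ∨≡xor-xor-∧ false false = refl
  ∨≡xor-xor-∧ false true  = refl
  ∨≡xor-xor-∧ true  false = refl
  ∨≡xor-xor-∧ true  true  = refl

∁≡⊤⊕ : (p : Subset m) → ∁ p ≡ ⊤ ⊕ p
∁≡⊤⊕ []      = refl
∁≡⊤⊕ (x ∷ p) = cong (not x ∷_) (∁≡⊤⊕ p)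

𝓑-∪ : 𝓑 N k A → 𝓑 N k C → 𝓑 N k (A ∪ C)
𝓑-∪ {A = A} {C = C} a c = subst (𝓑 _ _) (sym (∪≡⊕⊕∩ A C)) (add (add a c) (mul a c))

𝓑-∁ : 𝓑 N k A → 𝓑 N k (∁ A)
𝓑-∁ {A = A} a = subst (𝓑 _ _) (sym (∁≡⊤⊕ A)) (add unit a)

lookup≡false⇒∉ : lookup A u ≡ false → u ∉ A
lookup≡false⇒∉ eq u∈A with () ← trans (sym eq) ([]=⇒lookup u∈A)

lookup-∉ : u ∉ A → lookup A u ≡ false
lookup-∉ {u = u} {A = A} u∉A with lookup A u in eq
... | true  = contradiction (lookup⇒[]= u A eq) u∉A
... | false = refl

separates⇔lookup≢ : Separates A u v ⇔ (lookup A u ≢ lookup A v)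
separates⇔lookup≢ {A = A} {u} {v} = mk⇔ to from
  where
  to : Separates A u v → lookup A u ≢ lookup A v
  to (inj₁ (u∈A , v∉A)) eq = v∉A (lookup⇒[]= v A (trans (sym eq) ([]=⇒lookup u∈A)))
  to (inj₂ (u∉A , v∈A)) eq = u∉A (lookup⇒[]= u A (trans eq ([]=⇒lookup v∈A)))

  from : lookup A u ≢ lookup A v → Separates A u v
  from ne with lookup A u in eu | lookup A v in ev
  ... | true  | true  = contradiction refl ne
  ... | true  | false = inj₁ (lookup⇒[]= u A eu , lookup≡false⇒∉ ev)
  ... | false | true  = inj₂ (lookup≡false⇒∉ eu , lookup⇒[]= v A ev)
  ... | false | false = contradiction refl ne

𝓑-agrees : (∀ {C} → IsCut C → capacity N C ≤ k → ¬ Separates C u v) →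
           𝓑 N k X → lookup X u ≡ lookup X v
𝓑-agrees unseparated (gen C-cut C-small) =
  decidable-stable (_ Bool.≟ _) (λ ne → unseparated C-cut C-small (Equivalence.from separates⇔lookup≢ ne))
𝓑-agrees {u = u} {v = v} unseparated zero =
  trans (lookup-replicate u false) (sym (lookup-replicate v false))
𝓑-agrees {u = u} {v = v} unseparated unit =
  trans (lookup-replicate u true) (sym (lookup-replicate v true))
𝓑-agrees {u = u} {v = v} unseparated (add {A} {B} a b) = begin
  lookup (A ⊕ B) u            ≡⟨ lookup-zipWith _xor_ u A B ⟩
  lookup A u xor lookup B u   ≡⟨ cong₂ _xor_ (𝓑-agrees unseparated a) (𝓑-agrees unseparated b) ⟩
  lookup A v xor lookup B v   ≡⟨ lookup-zipWith _xor_ v A B ⟨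
  lookup (A ⊕ B) v            ∎
  where open ≡-Reasoning
𝓑-agrees {u = u} {v = v} unseparated (mul {A} {B} a b) = begin
  lookup (A ∩ B) u            ≡⟨ lookup-zipWith _∧_ u A B ⟩
  lookup A u ∧ lookup B u     ≡⟨ cong₂ _∧_ (𝓑-agrees unseparated a) (𝓑-agrees unseparated b) ⟩
  lookup A v ∧ lookup B v     ≡⟨ lookup-zipWith _∧_ v A B ⟨
  lookup (A ∩ B) v            ∎
  where open ≡-Reasoning

sum-map-≥ : {I : Set} (f : I → ℕ) {i : I} {is : List I} → i ∈ˡ is → f i ≤ sum (map f is)
sum-map-≥ f {is = j ∷ _} (here refl) = m≤m+n (f j) _
sum-map-≥ f {is = j ∷ _} (there i∈is) = ≤-trans (sum-map-≥ f i∈is) (m≤n+m _ (f j))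

crossing≤capacity : ∀ u v → crossing N A u v ≤ capacity N A
crossing≤capacity {N = N} {A = A} u v =
  ≤-trans (sum-map-≥ (crossing N A u) (∈-allFin v))
          (sum-map-≥ (λ u → sum (map (crossing N A u) (allFin _))) (∈-allFin u))

crossing-out : u ∈ A → v ∉ A → crossing N A u v ≡ cap N u v
crossing-out u∈A v∉A rewrite []=⇒lookup u∈A | lookup-∉ v∉A = refl

edge-leaving : Reach N u v → u ∈ A → v ∉ A → ∃[ x ] ∃[ y ] (x ∈ A × y ∉ A × Adj N x y)
edge-leaving here u∈A u∉A = contradiction u∈A u∉A
edge-leaving {A = A} (step {v = w} adj path) u∈A v∉A with w ∈? A
... | yes w∈A = edge-leaving path w∈A v∉A
... | no  w∉A = _ , w , u∈A , w∉A , adj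

cut-inhabited : IsCut A → Nonempty A × Nonempty (∁ A)
cut-inhabited {A = A} (A≢⊥ , A≢⊤) = inside , outside
  where
  inside : Nonempty A
  inside with nonempty? A
  ... | yes ne = ne
  ... | no  e  = contradiction (Empty-unique e) A≢⊥

  outside : Nonempty (∁ A)
  outside with nonempty? (∁ A)
  ... | yes ne = ne
  ... | no  e  = contradiction (⊆-antisym ⊆⊤ (λ {x} _ → x∉∁p⇒x∈p (λ x∈∁A → e (x , x∈∁A)))) A≢⊤

capacity-positive : Connected N → IsCut A → 1 ≤ capacity N A
capacity-positive {N = N} {A = A} connected A-cut
  with cut-inhabited A-cut
... | (a , a∈A) , (b , b∈∁A)
  with edge-leaving (connected a b) a∈A (x∈∁p⇒x∉p b∈∁A)
... | u , v , u∈A , v∉A , adj =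
  ≤-trans adj (≤-trans (≤-reflexive (sym (crossing-out {N = N} u∈A v∉A))) (crossing≤capacity {A = A} u v))

module _ {N : Network m} {k : ℕ} {A : Subset m}
  (separator : ∀ {u v} → u ∈ A → v ∉ A → ∃[ C ] (𝓑 N k C × u ∈ C × v ∉ C)) where

  private
    neighbourhood : u ∈ A → (vs : List (Fin m)) →
                    ∃[ D ] (𝓑 N k D × u ∈ D × (∀ {v} → v ∈ˡ vs → v ∉ A → v ∉ D))
    neighbourhood u∈A [] = ⊤ , unit , ∈⊤ , λ ()
    neighbourhood u∈A (w ∷ vs) with neighbourhood u∈A vs | w ∈? A
    ... | D , D∈𝓑 , u∈D , avoids | yes w∈A =
      D , D∈𝓑 , u∈D , λ { (here refl) w∉A → contradiction w∈A w∉A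
                         ; (there v∈vs) → avoids v∈vs }
    ... | D , D∈𝓑 , u∈D , avoids | no w∉A with separator u∈A w∉A
    ... | C , C∈𝓑 , u∈C , w∉C =
      D ∩ C , mul D∈𝓑 C∈𝓑 , x∈p∩q⁺ (u∈D , u∈C) ,
      λ { (here refl) _ w∈D∩C → w∉C (proj₂ (x∈p∩q⁻ D C w∈D∩C))
        ; (there v∈vs) v∉A v∈D∩C → avoids v∈vs v∉A (proj₁ (x∈p∩q⁻ D C v∈D∩C)) }

    neighbourhood⊆ : u ∈ A → ∃[ D ] (𝓑 N k D × u ∈ D × D ⊆ A)
    neighbourhood⊆ u∈A with neighbourhood u∈A (allFin _)
    ... | D , D∈𝓑 , u∈D , avoids =
      D , D∈𝓑 , u∈D , λ {v} v∈D → decidable-stable (v ∈? A) (λ v∉A → avoids (∈-allFin v) v∉A v∈D)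

    cover : (us : List (Fin m)) → ∃[ U ] (𝓑 N k U × U ⊆ A × (∀ {u} → u ∈ˡ us → u ∈ A → u ∈ U))
    cover [] = ⊥ , zero , (λ x∈⊥ → contradiction x∈⊥ ∉⊥) , λ ()
    cover (w ∷ us) with cover us | w ∈? A
    ... | U , U∈𝓑 , U⊆A , covers | no w∉A =
      U , U∈𝓑 , U⊆A , λ { (here refl) w∈A → contradiction w∈A w∉A
                         ; (there u∈us) → covers u∈us }
    ... | U , U∈𝓑 , U⊆A , covers | yes w∈A with neighbourhood⊆ w∈A
    ... | D , D∈𝓑 , w∈D , D⊆A =
      U ∪ D , 𝓑-∪ U∈𝓑 D∈𝓑 , (λ x∈U∪D → [ U⊆A , D⊆A ] (x∈p∪q⁻ U D x∈U∪D)) ,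
      λ { (here refl) _ → x∈p∪q⁺ (inj₂ w∈D)
        ; (there u∈us) u∈A → x∈p∪q⁺ (inj₁ (covers u∈us u∈A)) }

  𝓑-of-separators : 𝓑 N k A
  𝓑-of-separators with cover (allFin _)
  ... | U , U∈𝓑 , U⊆A , covers =
    subst (𝓑 N k) (⊆-antisym U⊆A (λ {u} u∈A → covers (∈-allFin u) u∈A)) U∈𝓑

<⇒≤∸1 : ∀ {a n} → a < n → a ≤ n ∸ 1
<⇒≤∸1 (s≤s a≤n) = a≤n

≤∸1⇒< : ∀ {a n} → 1 ≤ n → a ≤ n ∸ 1 → a < n
≤∸1⇒< {n = suc n} _ a≤n = s≤s a≤n

thin⇒∉𝓑 : Connected N → IsCut A → Thin N A u v → ¬ 𝓑 N (capacity N A ∸ 1) A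
thin⇒∉𝓑 {N = N} {A = A} {u = u} {v = v} connected A-cut (A-sep , A-minimal) A∈𝓑 =
  Equivalence.to separates⇔lookup≢ A-sep (𝓑-agrees small-cuts-agree A∈𝓑)
  where
  small-cuts-agree : ∀ {C} → IsCut C → capacity N C ≤ capacity N A ∸ 1 → ¬ Separates C u v
  small-cuts-agree {C} C-cut C-small C-sep =
    <⇒≱ (≤∸1⇒< (capacity-positive connected A-cut) C-small) (A-minimal C C-cut C-sep)

CheaperSeparator : Network m → Subset m → Fin m → Fin m → Set
CheaperSeparator {m} N A u v =
  Σ[ B ∈ Subset m ] (IsCut B × Separates B u v × capacity N B < capacity N A)

separates? : (A : Subset m) (u v : Fin m) → Dec (Separates A u v)
separates? A u v = ((u ∈? A) ×-dec ¬? (v ∈? A)) ⊎-dec (¬? (u ∈? A) ×-dec (v ∈? A))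

isCut? : (A : Subset m) → Dec (IsCut A)
isCut? A = ¬? (≡-dec Bool._≟_ A ⊥) ×-dec ¬? (≡-dec Bool._≟_ A ⊤)

cheaperSeparator? : (N : Network m) (A : Subset m) (u v : Fin m) → Dec (CheaperSeparator N A u v)
cheaperSeparator? N A u v =
  anySubset? (λ B → isCut? B ×-dec (separates? B u v ×-dec (suc (capacity N B) ≤? capacity N A)))

no-cheaper⇒thin : Separates A u v → ¬ CheaperSeparator N A u v → Thin N A u v
no-cheaper⇒thin A-sep none = A-sep , λ B B-cut B-sep → ≮⇒≥ (λ B<A → none (B , B-cut , B-sep , B<A))

cheaper⇒𝓑-separator : CheaperSeparator N A u v → ∃[ C ] (𝓑 N (capacity N A ∸ 1) C × u ∈ C × v ∉ C)
cheaper⇒𝓑-separator (B , B-cut , inj₁ (u∈B , v∉B) , B<A) =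
  B , gen B-cut (<⇒≤∸1 B<A) , u∈B , v∉B
cheaper⇒𝓑-separator (B , B-cut , inj₂ (u∉B , v∈B) , B<A) =
  ∁ B , 𝓑-∁ (gen B-cut (<⇒≤∸1 B<A)) , x∉p⇒x∈∁p u∉B , x∈p⇒x∉∁p v∈B

∉𝓑⇒thin : ¬ 𝓑 N (capacity N A ∸ 1) A → ∃[ u ] ∃[ v ] Thin N A u v
∉𝓑⇒thin {N = N} {A = A} A∉𝓑
  with any? (λ u → any? (λ v → separates? A u v ×-dec ¬? (cheaperSeparator? N A u v)))
... | yes (u , v , A-sep , none) = u , v , no-cheaper⇒thin A-sep none
... | no no-thin-pair = contradiction (𝓑-of-separators separator) A∉𝓑
  where
  separator : u ∈ A → v ∉ A → ∃[ C ] (𝓑 N (capacity N A ∸ 1) C × u ∈ C × v ∉ C)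
  separator {u} {v} u∈A v∉A = cheaper⇒𝓑-separator {A = A} (decidable-stable (cheaperSeparator? N A u v)
    (λ none → no-thin-pair (u , v , inj₁ (u∈A , v∉A) , none)))

mainTheorem2 : ∀ {m} (N : Network m) → Connected N →
    (A : Subset m) → IsCut A →
    (¬ 𝓑 N (capacity N A ∸ 1) A) ⇔ (Σ[ u ∈ Fin m ] Σ[ v ∈ Fin m ] Thin N A u v)
mainTheorem2 N connected A A-cut =
  mk⇔ ∉𝓑⇒thin (λ (_ , _ , thin) → thin⇒∉𝓑 connected A-cut thin)
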